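{- Let $\mathbf{a},\mathbf{b}\in\mathbb{N}^n$ with $\sum_{i=1}^n a_i=\sum_{i=1}^n b_i=N$, let $l_i:=\min\{a_i,b_i\}$, $u_i:=\max\{a_i,b_i\}$ for $i\in[n]$, and let $P:=\{\mathbf{x}\in\mathbb{R}^n : \mathbf{l}\le\mathbf{x}\le\mathbf{u},\ \sum_{i=1}^n x_i=N\}$. Two distinct vertices $\mathbf{x}$ and $\mathbf{y}$ of $P$ are adjacent on the skeleton of $P$ if and only if there exist two indices $i,j\in[n]$ such that: (1) $y_k=x_k\in\{l_k,u_k\}$ for all $k\in[n]$ with $k\ne i,j$; (2) $y_j=x_j+\delta_{ij}$; (3) $y_i=x_i-\delta_{ij}$, where $\delta_{ij}=\min\{u_j-x_j,\ x_i-l_i\}$.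
   Formalization: The polytope P is taken in ℚ^n instead of ℝ^n, so its vertices and the points and coefficients used in defining vertices and adjacency on the skeleton are rational. -}

module Defs where

open import Data.Nat as ℕ using (ℕ)
open import Data.Fin using (Fin; zero; suc)
open import Data.Integer using (+_)
open import Data.Rational using (ℚ; 0ℚ; 1ℚ; _/_; _+_; _-_; _*_; _≤_; _<_; _⊓_)
open import Data.Product using (_×_; ∃)
open import Relation.Binary.PropositionalEquality using (_≡_)
open import Relation.Nullary using (¬_)

sumℕ : ∀ {n} → (Fin n → ℕ) → ℕ
sumℕ {ℕ.zero}  f = 0
sumℕ {ℕ.suc n} f = f zero ℕ.+ sumℕ (λ i → f (suc i))

sumℚ : ∀ {n} → (Fin n → ℚ) → ℚ
sumℚ {ℕ.zero}  f = 0ℚ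
sumℚ {ℕ.suc n} f = f zero + sumℚ (λ i → f (suc i))

ℕ→ℚ : ℕ → ℚ
ℕ→ℚ m = + m / 1

Pt : ℕ → Set
Pt n = Fin n → ℚ

lo : ∀ {n} → (Fin n → ℕ) → (Fin n → ℕ) → Pt n
lo a b i = ℕ→ℚ (a i ℕ.⊓ b i)

up : ∀ {n} → (Fin n → ℕ) → (Fin n → ℕ) → Pt n
up a b i = ℕ→ℚ (a i ℕ.⊔ b i)

InP : ∀ {n} → (a b : Fin n → ℕ) → ℕ → Pt n → Set
InP a b N x = (∀ i → lo a b i ≤ x i × x i ≤ up a b i) × sumℚ x ≡ ℕ→ℚ N

comb : ∀ {n} → ℚ → Pt n → Pt n → Pt n
comb t y z i = t * y i + (1ℚ - t) * z i

_≐_ : ∀ {n} → Pt n → Pt n → Set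
x ≐ y = ∀ i → x i ≡ y i

IsVertex : ∀ {n} → (a b : Fin n → ℕ) → ℕ → Pt n → Set
IsVertex a b N x =
  InP a b N x ×
  (∀ y z t → InP a b N y → InP a b N z → 0ℚ < t → t < 1ℚ →
     x ≐ comb t y z → (y ≐ x × z ≐ x))

OnSeg : ∀ {n} → Pt n → Pt n → Pt n → Set
OnSeg x y w = ∃ λ t → 0ℚ ≤ t × t ≤ 1ℚ × w ≐ comb t x y

-- the segment [x,y] is a face of P (so x,y distinct vertices are adjacent
-- on the skeleton / span an edge of P)
SegIsFace : ∀ {n} → (a b : Fin n → ℕ) → ℕ → Pt n → Pt n → Set
SegIsFace a b N x y =
  ∀ z w t → InP a b N z → InP a b N w → 0ℚ < t → t < 1ℚ →
    OnSeg x y (comb t z w) → (OnSeg x y z × OnSeg x y w)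

Adjacent : ∀ {n} → (a b : Fin n → ℕ) → ℕ → Pt n → Pt n → Set
Adjacent a b N x y =
  IsVertex a b N x × IsVertex a b N y × ¬ (x ≐ y) × SegIsFace a b N x y

-- A point of P can be a vertex only if at most one of its coordinates lies strictly between its bounds:
-- with two such coordinates i, j, moving by ±ε along e_i − e_j stays inside P.
-- Let [x, y] be an edge and pick i with y_i < x_i and j with x_j < y_j (the coordinate sums agree). At the
-- midpoint m every coordinate where x and y differ is strictly inside its bounds; if some k ∉ {i, j} were,
-- moving m along e_k − e_i would have to stay on the edge, which the j-coordinate forbids. So x and y agree
-- outside {i, j}, and there x sits on a bound; the coordinate sum gives y = x + d (e_j − e_i) with d ≤ δ_ij,
-- and d < δ_ij would leave y with two interior coordinates.
-- Conversely, if y = x + δ_ij (e_j − e_i), a convex combination of z, w ∈ P lying on [x, y] forces z and w to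
-- equal x at its bound coordinates, hence z = x + d (e_j − e_i) with 0 ≤ d ≤ δ_ij (d ≥ 0 because the vertex x
-- is tight at u_i or at l_j), which is a point of [x, y].
module Submission where

open import Defs
open import Data.Fin using (Fin; zero; suc)
open import Data.Fin.Properties using (any?; suc-injective) renaming (_≟_ to _≟ᶠ_)
open import Data.Nat using (ℕ)
open import Data.Product using (_×_; _,_; ∃; ∃₂; proj₁; proj₂)
open import Data.Rational
  using (ℚ; 0ℚ; 1ℚ; ½; _+_; _-_; _*_; -_; _⊓_; _⊔_; _≤_; _<_; 1/_; positive; nonNegative; >-nonZero; ≢-nonZero)
open import Data.Rational.Properties
open import Algebra.Properties.Group +-0-group
  using (identityʳ-unique; inverseˡ-unique; ∙-cancelʳ; x∙y⁻¹≈ε⇒x≈y; ⁻¹-involutive)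
open import Data.Sum using (_⊎_; inj₁; inj₂; [_,_]′)
open import Function using (_∘_; _⇔_; mk⇔)
open import Level using (0ℓ)
open import Relation.Binary.Definitions using (tri<; tri≈; tri>)
open import Relation.Binary.PropositionalEquality
open import Relation.Nullary using (¬_; yes; no; contradiction)
open import Relation.Nullary.Decidable using (dec⇒maybe; toWitness; decidable-stable)
open import Tactic.RingSolver using (solve-∀)
open import Tactic.RingSolver.Core.AlmostCommutativeRing using (AlmostCommutativeRing; fromCommutativeRing)

ℚ-ring : AlmostCommutativeRing 0ℓ 0ℓ
ℚ-ring = fromCommutativeRing +-*-commutativeRing (λ p → dec⇒maybe (0ℚ ≟ p))

add-sub-cancel : ∀ p q → p + (q - p) ≡ q
add-sub-cancel = solve-∀ ℚ-ring

sub-sub-cancel : ∀ p q → p - (p - q) ≡ q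
sub-sub-cancel = solve-∀ ℚ-ring

sub-telescope : ∀ p q r → q - r + (r - p) ≡ q - p
sub-telescope = solve-∀ ℚ-ring

p≤q⇒0≤q-p : ∀ {p q} → p ≤ q → 0ℚ ≤ q - p
p≤q⇒0≤q-p {p} {q} p≤q = subst (_≤ q - p) (+-inverseʳ p) (+-monoˡ-≤ (- p) p≤q)

p<q⇒0<q-p : ∀ {p q} → p < q → 0ℚ < q - p
p<q⇒0<q-p {p} {q} p<q = subst (_< q - p) (+-inverseʳ p) (+-monoˡ-< (- p) p<q)

p≤q-r⇒r≤q-p : ∀ {p q r} → p ≤ q - r → r ≤ q - p
p≤q-r⇒r≤q-p {p} {q} {r} h = subst₂ _≤_ (add-sub-cancel p r) (sub-telescope p q r) (+-monoˡ-≤ (r - p) h)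

p<q-r⇒r<q-p : ∀ {p q r} → p < q - r → r < q - p
p<q-r⇒r<q-p {p} {q} {r} h = subst₂ _<_ (add-sub-cancel p r) (sub-telescope p q r) (+-monoˡ-< (r - p) h)

r≤q-p⇒p+r≤q : ∀ {p q r} → r ≤ q - p → p + r ≤ q
r≤q-p⇒p+r≤q {p} {q} h = subst (p + _ ≤_) (add-sub-cancel p q) (+-monoʳ-≤ p h)

r<q-p⇒p+r<q : ∀ {p q r} → r < q - p → p + r < q
r<q-p⇒p+r<q {p} {q} h = subst (p + _ <_) (add-sub-cancel p q) (+-monoʳ-< p h)

0<q-p⇒p<q : ∀ {p q} → 0ℚ < q - p → p < q
0<q-p⇒p<q {p} h = subst (_< _) (+-identityʳ p) (r<q-p⇒p+r<q h)

p-r≤p+r : ∀ p {r} → 0ℚ ≤ r → p - r ≤ p + r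
p-r≤p+r p 0≤r = +-monoʳ-≤ p (≤-trans (neg-antimono-≤ 0≤r) 0≤r)

p-r<p+r : ∀ p {r} → 0ℚ < r → p - r < p + r
p-r<p+r p 0<r = +-monoʳ-< p (<-trans (neg-antimono-< 0<r) 0<r)

≤⇒<⊎≡ : ∀ {p q} → p ≤ q → p < q ⊎ p ≡ q
≤⇒<⊎≡ {p} {q} p≤q with <-cmp p q
... | tri< p<q _ _ = inj₁ p<q
... | tri≈ _ p≡q _ = inj₂ p≡q
... | tri> _ _ q<p = contradiction (≤-<-trans p≤q q<p) (<-irrefl refl)

⊓-positive : ∀ {p q} → 0ℚ < p → 0ℚ < q → 0ℚ < p ⊓ q
⊓-positive {p} {q} 0<p 0<q with ⊓-sel p q
... | inj₁ p⊓q≡p = subst (0ℚ <_) (sym p⊓q≡p) 0<p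
... | inj₂ p⊓q≡q = subst (0ℚ <_) (sym p⊓q≡q) 0<q

+-mono-≤-equality : ∀ {a b c d} → a ≤ b → c ≤ d → a + c ≡ b + d → a ≡ b × c ≡ d
+-mono-≤-equality a≤b c≤d eq =
  ≤-antisym a≤b (≮⇒≥ λ a<b → <-irrefl eq (+-mono-<-≤ a<b c≤d)) ,
  ≤-antisym c≤d (≮⇒≥ λ c<d → <-irrefl eq (+-mono-≤-< a≤b c<d))

*-cancelʳ-≢0 : ∀ {p q r} → r ≢ 0ℚ → p * r ≡ q * r → p ≡ q
*-cancelʳ-≢0 {p} {q} {r} r≢0 eq = trans (sym (divide p)) (trans (cong (_* 1/ r) eq) (divide q))
  where
  instance _ = ≢-nonZero r≢0
  divide : ∀ s → s * r * 1/ r ≡ s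
  divide s = trans (*-assoc s r (1/ r)) (trans (cong (s *_) (*-inverseʳ r)) (*-identityʳ s))

0<½ : 0ℚ < ½
0<½ = toWitness {a? = 0ℚ <? ½} _

½<1 : ½ < 1ℚ
½<1 = toWitness {a? = ½ <? 1ℚ} _

mix : ℚ → ℚ → ℚ → ℚ
mix t p q = t * p + (1ℚ - t) * q

mix-idem : ∀ t p → mix t p p ≡ p
mix-idem = idem
  where
  idem : ∀ t p → t * p + (1ℚ - t) * p ≡ p
  idem = solve-∀ ℚ-ring

mix-shift-+ : ∀ r p c → mix r p (p + c) ≡ p + (1ℚ - r) * c
mix-shift-+ = shift
  where
  shift : ∀ r p c → r * p + (1ℚ - r) * (p + c) ≡ p + (1ℚ - r) * c
  shift = solve-∀ ℚ-ring

mix-shift-- : ∀ r p c → mix r p (p - c) ≡ p - (1ℚ - r) * c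
mix-shift-- = shift
  where
  shift : ∀ r p c → r * p + (1ℚ - r) * (p - c) ≡ p - (1ℚ - r) * c
  shift = solve-∀ ℚ-ring

mix-mono-≤ : ∀ {t p p′ q q′} → 0ℚ ≤ t → t ≤ 1ℚ → p ≤ p′ → q ≤ q′ → mix t p q ≤ mix t p′ q′
mix-mono-≤ {t} 0≤t t≤1 p≤p′ q≤q′ =
  +-mono-≤ (*-monoˡ-≤-nonNeg t {{nonNegative 0≤t}} p≤p′)
           (*-monoˡ-≤-nonNeg (1ℚ - t) {{nonNegative (p≤q⇒0≤q-p t≤1)}} q≤q′)

mix-mono-<ˡ : ∀ {t p p′ q q′} → 0ℚ < t → t ≤ 1ℚ → p < p′ → q ≤ q′ → mix t p q < mix t p′ q′
mix-mono-<ˡ {t} 0<t t≤1 p<p′ q≤q′ =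
  +-mono-<-≤ (*-monoʳ-<-pos t {{positive 0<t}} p<p′)
             (*-monoˡ-≤-nonNeg (1ℚ - t) {{nonNegative (p≤q⇒0≤q-p t≤1)}} q≤q′)

mix-mono-<ʳ : ∀ {t p p′ q q′} → 0ℚ ≤ t → t < 1ℚ → p ≤ p′ → q < q′ → mix t p q < mix t p′ q′
mix-mono-<ʳ {t} 0≤t t<1 p≤p′ q<q′ =
  +-mono-≤-< (*-monoˡ-≤-nonNeg t {{nonNegative 0≤t}} p≤p′)
             (*-monoʳ-<-pos (1ℚ - t) {{positive (p<q⇒0<q-p t<1)}} q<q′)

mix-injective : ∀ {s t p q} → p ≢ q → mix s p q ≡ mix t p q → s ≡ t
mix-injective {s} {t} {p} {q} p≢q eq =
  *-cancelʳ-≢0 (p≢q ∘ x∙y⁻¹≈ε⇒x≈y p q)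
    (∙-cancelʳ q (s * (p - q)) (t * (p - q)) (trans (sym (affine s p q)) (trans eq (affine t p q))))
  where
  affine : ∀ t p q → t * p + (1ℚ - t) * q ≡ t * (p - q) + q
  affine = solve-∀ ℚ-ring

mix-strictly-between : ∀ {t p q} → 0ℚ < t → t < 1ℚ → p ≢ q → p ⊓ q < mix t p q × mix t p q < p ⊔ q
mix-strictly-between {t} {p} {q} 0<t t<1 p≢q with <-cmp p q
... | tri< p<q _ _ =
  subst₂ _<_ (trans (mix-idem t p) (sym (p≤q⇒p⊓q≡p (<⇒≤ p<q)))) refl (mix-mono-<ʳ (<⇒≤ 0<t) t<1 ≤-refl p<q) ,
  subst₂ _<_ refl (trans (mix-idem t q) (sym (p≤q⇒p⊔q≡q (<⇒≤ p<q)))) (mix-mono-<ˡ 0<t (<⇒≤ t<1) p<q ≤-refl)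
... | tri≈ _ p≡q _ = contradiction p≡q p≢q
... | tri> _ _ q<p =
  subst₂ _<_ (trans (mix-idem t q) (sym (p≥q⇒p⊓q≡q (<⇒≤ q<p)))) refl (mix-mono-<ˡ 0<t (<⇒≤ t<1) q<p ≤-refl) ,
  subst₂ _<_ refl (trans (mix-idem t p) (sym (p≥q⇒p⊔q≡p (<⇒≤ q<p)))) (mix-mono-<ʳ (<⇒≤ 0<t) t<1 ≤-refl q<p)

mix-at-lower : ∀ {t l p q} → 0ℚ < t → t < 1ℚ → l ≤ p → l ≤ q → mix t p q ≡ l → p ≡ l × q ≡ l
mix-at-lower {t} {l} 0<t t<1 l≤p l≤q eq =
  ≤-antisym (≮⇒≥ λ l<p → <-irrefl (sym eq) (subst (_< _) (mix-idem t l) (mix-mono-<ˡ 0<t (<⇒≤ t<1) l<p l≤q))) l≤p ,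
  ≤-antisym (≮⇒≥ λ l<q → <-irrefl (sym eq) (subst (_< _) (mix-idem t l) (mix-mono-<ʳ (<⇒≤ 0<t) t<1 l≤p l<q))) l≤q

mix-at-upper : ∀ {t u p q} → 0ℚ < t → t < 1ℚ → p ≤ u → q ≤ u → mix t p q ≡ u → p ≡ u × q ≡ u
mix-at-upper {t} {u} 0<t t<1 p≤u q≤u eq =
  ≤-antisym p≤u (≮⇒≥ λ p<u → <-irrefl eq (subst (_ <_) (mix-idem t u) (mix-mono-<ˡ 0<t (<⇒≤ t<1) p<u q≤u))) ,
  ≤-antisym q≤u (≮⇒≥ λ q<u → <-irrefl eq (subst (_ <_) (mix-idem t u) (mix-mono-<ʳ (<⇒≤ 0<t) t<1 p≤u q<u)))

segment-parameter : ∀ {d δ} → 0ℚ < δ → 0ℚ ≤ d → d ≤ δ → ∃ λ r → 0ℚ ≤ r × r ≤ 1ℚ × (1ℚ - r) * δ ≡ d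
segment-parameter {d} {δ} 0<δ 0≤d d≤δ =
  1ℚ - q , p≤q⇒0≤q-p q≤1 , +-monoʳ-≤ 1ℚ (neg-antimono-≤ 0≤q) , trans (cong (_* δ) (sub-sub-cancel 1ℚ q)) q*δ≡d
  where
  instance
    _ = >-nonZero 0<δ
    _ = positive 0<δ
  q = d * 1/ δ
  q*δ≡d : q * δ ≡ d
  q*δ≡d = trans (*-assoc d (1/ δ) δ) (trans (cong (d *_) (*-inverseˡ δ)) (*-identityʳ d))
  q≤1 : q ≤ 1ℚ
  q≤1 = *-cancelʳ-≤-pos δ (subst₂ _≤_ (sym q*δ≡d) (sym (*-identityˡ δ)) d≤δ)
  0≤q : 0ℚ ≤ q
  0≤q = *-cancelʳ-≤-pos δ (subst₂ _≤_ (sym (*-zeroˡ δ)) (sym q*δ≡d) 0≤d)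

sumℚ-distrib-+ : ∀ {n} (f g : Pt n) → sumℚ (λ k → f k + g k) ≡ sumℚ f + sumℚ g
sumℚ-distrib-+ {ℕ.zero}  f g = refl
sumℚ-distrib-+ {ℕ.suc n} f g =
  trans (cong (f zero + g zero +_) (sumℚ-distrib-+ (f ∘ suc) (g ∘ suc)))
        (interchange (f zero) (g zero) (sumℚ (f ∘ suc)) (sumℚ (g ∘ suc)))
  where
  interchange : ∀ a b c d → a + b + (c + d) ≡ a + c + (b + d)
  interchange = solve-∀ ℚ-ring

sumℚ-distrib-- : ∀ {n} (f g : Pt n) → sumℚ (λ k → f k - g k) ≡ sumℚ f - sumℚ g
sumℚ-distrib-- {ℕ.zero}  f g = refl
sumℚ-distrib-- {ℕ.suc n} f g =
  trans (cong (f zero - g zero +_) (sumℚ-distrib-- (f ∘ suc) (g ∘ suc)))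
        (interchange (f zero) (g zero) (sumℚ (f ∘ suc)) (sumℚ (g ∘ suc)))
  where
  interchange : ∀ a b c d → a - b + (c - d) ≡ a + c - (b + d)
  interchange = solve-∀ ℚ-ring

*-distribˡ-sumℚ : ∀ {n} c (f : Pt n) → sumℚ (λ k → c * f k) ≡ c * sumℚ f
*-distribˡ-sumℚ {ℕ.zero}  c f = sym (*-zeroʳ c)
*-distribˡ-sumℚ {ℕ.suc n} c f =
  trans (cong (c * f zero +_) (*-distribˡ-sumℚ c (f ∘ suc))) (sym (*-distribˡ-+ c _ _))

sumℚ-zeros : ∀ {n} (h : Pt n) → (∀ k → h k ≡ 0ℚ) → sumℚ h ≡ 0ℚ
sumℚ-zeros {ℕ.zero}  h zeros = refl
sumℚ-zeros {ℕ.suc n} h zeros = cong₂ _+_ (zeros zero) (sumℚ-zeros (h ∘ suc) (zeros ∘ suc))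

sumℚ-single : ∀ {n} (h : Pt n) i → (∀ k → k ≢ i → h k ≡ 0ℚ) → sumℚ h ≡ h i
sumℚ-single h zero off =
  trans (cong (h zero +_) (sumℚ-zeros (h ∘ suc) (λ k → off (suc k) (λ ())))) (+-identityʳ (h zero))
sumℚ-single h (suc i) off =
  trans (cong₂ _+_ (off zero (λ ())) (sumℚ-single (h ∘ suc) i (λ k k≢i → off (suc k) (k≢i ∘ suc-injective))))
        (+-identityˡ (h (suc i)))

sumℚ-pair : ∀ {n} (h : Pt n) {i j} → i ≢ j → (∀ k → k ≢ i → k ≢ j → h k ≡ 0ℚ) → sumℚ h ≡ h i + h j
sumℚ-pair h {zero}  {zero}  i≢j off = contradiction refl i≢j
sumℚ-pair h {zero}  {suc j} i≢j off =
  cong (h zero +_) (sumℚ-single (h ∘ suc) j (λ k k≢j → off (suc k) (λ ()) (k≢j ∘ suc-injective)))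
sumℚ-pair h {suc i} {zero}  i≢j off =
  trans (cong (h zero +_) (sumℚ-single (h ∘ suc) i (λ k k≢i → off (suc k) (k≢i ∘ suc-injective) (λ ()))))
        (+-comm (h zero) (h (suc i)))
sumℚ-pair h {suc i} {suc j} i≢j off =
  trans (cong₂ _+_ (off zero (λ ()) (λ ()))
                   (sumℚ-pair (h ∘ suc) (i≢j ∘ cong suc)
                              (λ k k≢i k≢j → off (suc k) (k≢i ∘ suc-injective) (k≢j ∘ suc-injective))))
        (+-identityˡ _)

sumℚ-mono-≤ : ∀ {n} (f g : Pt n) → (∀ k → f k ≤ g k) → sumℚ f ≤ sumℚ g
sumℚ-mono-≤ {ℕ.zero}  f g f≤g = ≤-refl
sumℚ-mono-≤ {ℕ.suc n} f g f≤g = +-mono-≤ (f≤g zero) (sumℚ-mono-≤ (f ∘ suc) (g ∘ suc) (f≤g ∘ suc))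

sumℚ-mono-≤-equality : ∀ {n} (f g : Pt n) → (∀ k → f k ≤ g k) → sumℚ f ≡ sumℚ g → f ≐ g
sumℚ-mono-≤-equality {ℕ.suc n} f g f≤g eq zero =
  proj₁ (+-mono-≤-equality (f≤g zero) (sumℚ-mono-≤ (f ∘ suc) (g ∘ suc) (f≤g ∘ suc)) eq)
sumℚ-mono-≤-equality {ℕ.suc n} f g f≤g eq (suc k) =
  sumℚ-mono-≤-equality (f ∘ suc) (g ∘ suc) (f≤g ∘ suc)
    (proj₂ (+-mono-≤-equality (f≤g zero) (sumℚ-mono-≤ (f ∘ suc) (g ∘ suc) (f≤g ∘ suc)) eq)) k

sumℚ-≡⇒decrease×increase : ∀ {n} {x y : Pt n} → sumℚ x ≡ sumℚ y → ¬ x ≐ y →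
  ∃₂ λ i j → y i < x i × x j < y j
sumℚ-≡⇒decrease×increase {x = x} {y} Σx≡Σy x≢y with any? (λ k → y k <? x k)
... | no ¬decrease =
  contradiction (sumℚ-mono-≤-equality x y (λ k → ≮⇒≥ (¬decrease ∘ (k ,_))) Σx≡Σy) x≢y
... | yes (i , yi<xi) with any? (λ k → x k <? y k)
...   | yes (j , xj<yj) = i , j , yi<xi , xj<yj
...   | no ¬increase =
  contradiction (sumℚ-mono-≤-equality y x (λ k → ≮⇒≥ (¬increase ∘ (k ,_))) (sym Σx≡Σy) i) (<⇒≢ yi<xi)

pair-cases : ∀ {n} {P : Fin n → Set} i j → P i → P j → (∀ k → k ≢ i → k ≢ j → P k) → ∀ k → P k
pair-cases i j Pi Pj Poff k with k ≟ᶠ i | k ≟ᶠ j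
... | yes refl | _        = Pi
... | no _     | yes refl = Pj
... | no k≢i   | no k≢j   = Poff k k≢i k≢j

translate : ∀ {n} → Pt n → ℚ → Pt n → Pt n
translate p c v k = p k + c * v k

translate-midpoint : ∀ {n} (p : Pt n) ε v → comb ½ (translate p ε v) (translate p (- ε) v) ≐ p
translate-midpoint p ε v k = midpoint (p k) ε (v k)
  where
  midpoint : ∀ p ε e → ½ * (p + ε * e) + (1ℚ - ½) * (p + - ε * e) ≡ p
  midpoint = solve-∀ ℚ-ring

sumℚ-translate : ∀ {n} (p : Pt n) c v → sumℚ (translate p c v) ≡ sumℚ p + c * sumℚ v
sumℚ-translate p c v = trans (sumℚ-distrib-+ p (λ k → c * v k)) (cong (sumℚ p +_) (*-distribˡ-sumℚ c v))

transfer : ∀ {n} → Fin n → Fin n → Pt n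
transfer i j k with k ≟ᶠ i | k ≟ᶠ j
... | yes _ | _     = 1ℚ
... | no _  | yes _ = - 1ℚ
... | no _  | no _  = 0ℚ

module _ {n} {i j : Fin n} where

  transfer-source : transfer i j i ≡ 1ℚ
  transfer-source with i ≟ᶠ i
  ... | yes _   = refl
  ... | no i≢i = contradiction refl i≢i

  transfer-target : i ≢ j → transfer i j j ≡ - 1ℚ
  transfer-target i≢j with j ≟ᶠ i | j ≟ᶠ j
  ... | yes j≡i | _       = contradiction (sym j≡i) i≢j
  ... | no _    | yes _   = refl
  ... | no _    | no j≢j = contradiction refl j≢j

  transfer-off : ∀ {k} → k ≢ i → k ≢ j → transfer i j k ≡ 0ℚ
  transfer-off {k} k≢i k≢j with k ≟ᶠ i | k ≟ᶠ j
  ... | yes k≡i | _       = contradiction k≡i k≢i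
  ... | no _    | yes k≡j = contradiction k≡j k≢j
  ... | no _    | no _    = refl

  sumℚ-transfer : i ≢ j → sumℚ (transfer i j) ≡ 0ℚ
  sumℚ-transfer i≢j =
    trans (sumℚ-pair (transfer i j) i≢j (λ _ → transfer-off))
          (trans (cong₂ _+_ transfer-source (transfer-target i≢j)) (+-inverseʳ 1ℚ))

  module _ (p : Pt n) (c : ℚ) where

    translate-transfer-source : translate p c (transfer i j) i ≡ p i + c
    translate-transfer-source =
      trans (cong (λ e → p i + c * e) transfer-source) (cong (p i +_) (*-identityʳ c))

    translate-transfer-target : i ≢ j → translate p c (transfer i j) j ≡ p j - c
    translate-transfer-target i≢j =
      trans (cong (λ e → p j + c * e) (transfer-target i≢j))
            (cong (p j +_) (trans (sym (neg-distribʳ-* c 1ℚ)) (cong -_ (*-identityʳ c))))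

    translate-transfer-off : ∀ {k} → k ≢ i → k ≢ j → translate p c (transfer i j) k ≡ p k
    translate-transfer-off {k} k≢i k≢j =
      trans (cong (λ e → p k + c * e) (transfer-off k≢i k≢j)) (trans (cong (p k +_) (*-zeroʳ c)) (+-identityʳ (p k)))

module _ {n} (a b : Fin n → ℕ) where

  InBox : Fin n → ℚ → Set
  InBox k q = lo a b k ≤ q × q ≤ up a b k

  Interior : Fin n → ℚ → Set
  Interior k q = lo a b k < q × q < up a b k

  Room : Fin n → ℚ → ℚ → Set
  Room k q ε = InBox k (q - ε) × InBox k (q + ε)

  slack : Fin n → ℚ → ℚ
  slack k q = (q - lo a b k) ⊓ (up a b k - q)

  δ : Pt n → Fin n → Fin n → ℚ
  δ x i j = (up a b j - x j) ⊓ (x i - lo a b i)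

  IsTransfer : Pt n → Pt n → Fin n → Fin n → Set
  IsTransfer x y i j =
    (∀ k → k ≢ i → k ≢ j → y k ≡ x k × (x k ≡ lo a b k ⊎ x k ≡ up a b k)) ×
    y j ≡ x j + δ x i j × y i ≡ x i - δ x i j

  box-cases : ∀ {k q} → InBox k q → q ≡ lo a b k ⊎ q ≡ up a b k ⊎ Interior k q
  box-cases (l≤q , q≤u) with ≤⇒<⊎≡ l≤q | ≤⇒<⊎≡ q≤u
  ... | inj₂ l≡q | _        = inj₁ (sym l≡q)
  ... | inj₁ _   | inj₂ q≡u = inj₂ (inj₁ q≡u)
  ... | inj₁ l<q | inj₁ q<u = inj₂ (inj₂ (l<q , q<u))

  midpoint-interior : ∀ {k p q} → InBox k p → InBox k q → p ≢ q → Interior k (mix ½ p q)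
  midpoint-interior (l≤p , p≤u) (l≤q , q≤u) p≢q =
    ≤-<-trans (⊓-glb l≤p l≤q) (proj₁ between) , <-≤-trans (proj₂ between) (⊔-lub p≤u q≤u)
    where between = mix-strictly-between 0<½ ½<1 p≢q

  mix-at-bound : ∀ {k t p q c} → 0ℚ < t → t < 1ℚ → InBox k p → InBox k q →
    c ≡ lo a b k ⊎ c ≡ up a b k → mix t p q ≡ c → p ≡ c × q ≡ c
  mix-at-bound 0<t t<1 (l≤p , _) (l≤q , _) (inj₁ refl) = mix-at-lower 0<t t<1 l≤p l≤q
  mix-at-bound 0<t t<1 (_ , p≤u) (_ , q≤u) (inj₂ refl) = mix-at-upper 0<t t<1 p≤u q≤u

  room-within-slack : ∀ k q {ε} → 0ℚ ≤ ε → ε ≤ slack k q → Room k q ε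
  room-within-slack k q {ε} 0≤ε ε≤slack =
    (l≤q-ε , ≤-trans (p-r≤p+r q 0≤ε) q+ε≤u) , (≤-trans l≤q-ε (p-r≤p+r q 0≤ε) , q+ε≤u)
    where
    l≤q-ε : lo a b k ≤ q - ε
    l≤q-ε = p≤q-r⇒r≤q-p {q = q} {lo a b k} (p≤q⊓r⇒p≤q (q - lo a b k) (up a b k - q) ε≤slack)
    q+ε≤u : q + ε ≤ up a b k
    q+ε≤u = r≤q-p⇒p+r≤q {q} {up a b k} (p≤q⊓r⇒p≤r (q - lo a b k) (up a b k - q) ε≤slack)

  interior-room : ∀ {i j q r} → Interior i q → Interior j r → ∃ λ ε → 0ℚ < ε × Room i q ε × Room j r ε
  interior-room {i} {j} {q} {r} (l<q , q<u) (l<r , r<u) =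
    ε , 0<ε , room-within-slack i q (<⇒≤ 0<ε) (p⊓q≤p (slack i q) (slack j r)) ,
              room-within-slack j r (<⇒≤ 0<ε) (p⊓q≤q (slack i q) (slack j r))
    where
    ε : ℚ
    ε = slack i q ⊓ slack j r
    0<ε : 0ℚ < ε
    0<ε = ⊓-positive (⊓-positive (p<q⇒0<q-p l<q) (p<q⇒0<q-p q<u)) (⊓-positive (p<q⇒0<q-p l<r) (p<q⇒0<q-p r<u))

  module _ (N : ℕ) where

    comb-InP : ∀ {t y z} → 0ℚ ≤ t → t ≤ 1ℚ → InP a b N y → InP a b N z → InP a b N (comb t y z)
    comb-InP {t} {y} {z} 0≤t t≤1 (y-box , Σy) (z-box , Σz) = box , sum
      where
      box : ∀ k → InBox k (comb t y z k)
      box k = subst (_≤ _) (mix-idem t (lo a b k)) (mix-mono-≤ 0≤t t≤1 (proj₁ (y-box k)) (proj₁ (z-box k))) ,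
              subst (_ ≤_) (mix-idem t (up a b k)) (mix-mono-≤ 0≤t t≤1 (proj₂ (y-box k)) (proj₂ (z-box k)))
      open ≡-Reasoning
      sum : sumℚ (comb t y z) ≡ ℕ→ℚ N
      sum = begin
        sumℚ (comb t y z)                                  ≡⟨ sumℚ-distrib-+ (λ k → t * y k) (λ k → (1ℚ - t) * z k) ⟩
        sumℚ (λ k → t * y k) + sumℚ (λ k → (1ℚ - t) * z k) ≡⟨ cong₂ _+_ (*-distribˡ-sumℚ t y) (*-distribˡ-sumℚ (1ℚ - t) z) ⟩
        mix t (sumℚ y) (sumℚ z)                            ≡⟨ cong₂ (mix t) Σy Σz ⟩
        mix t (ℕ→ℚ N) (ℕ→ℚ N)                              ≡⟨ mix-idem t (ℕ→ℚ N) ⟩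
        ℕ→ℚ N                                              ∎

    transfer-InP : ∀ {p i j} c → InP a b N p → i ≢ j → InBox i (p i + c) → InBox j (p j - c) →
                   InP a b N (translate p c (transfer i j))
    transfer-InP {p} {i} {j} c (p-box , Σp) i≢j i-box j-box =
      pair-cases {P = λ k → InBox k (translate p c (transfer i j) k)} i j
        (subst (InBox i) (sym (translate-transfer-source p c)) i-box)
        (subst (InBox j) (sym (translate-transfer-target p c i≢j)) j-box)
        (λ k k≢i k≢j → subst (InBox k) (sym (translate-transfer-off p c k≢i k≢j)) (p-box k)) ,
      (begin
        sumℚ (translate p c (transfer i j)) ≡⟨ sumℚ-translate p c (transfer i j) ⟩
        sumℚ p + c * sumℚ (transfer i j)    ≡⟨ cong (λ s → sumℚ p + c * s) (sumℚ-transfer i≢j) ⟩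
        sumℚ p + c * 0ℚ                     ≡⟨ cong (sumℚ p +_) (*-zeroʳ c) ⟩
        sumℚ p + 0ℚ                         ≡⟨ +-identityʳ (sumℚ p) ⟩
        sumℚ p                              ≡⟨ Σp ⟩
        ℕ→ℚ N                               ∎)
      where open ≡-Reasoning

    interior-pair-line : ∀ {p i j} → InP a b N p → i ≢ j → Interior i (p i) → Interior j (p j) →
      ∃ λ ε → 0ℚ < ε × InP a b N (translate p ε (transfer i j)) × InP a b N (translate p (- ε) (transfer i j))
    interior-pair-line {p} {i} {j} P i≢j i-int j-int = line (interior-room {i} {j} {p i} {p j} i-int j-int)
      where
      line : (∃ λ ε → 0ℚ < ε × Room i (p i) ε × Room j (p j) ε) →
        ∃ λ ε → 0ℚ < ε × InP a b N (translate p ε (transfer i j)) × InP a b N (translate p (- ε) (transfer i j))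
      line (ε , 0<ε , (i⁻ , i⁺) , (j⁻ , j⁺)) =
        ε , 0<ε , transfer-InP {p} {i} {j} ε P i≢j i⁺ j⁻ ,
        transfer-InP {p} {i} {j} (- ε) P i≢j i⁻ (subst (InBox j) (cong (p j +_) (sym (⁻¹-involutive ε))) j⁺)

    vertex-rigid : ∀ {x ε v} → IsVertex a b N x →
      InP a b N (translate x ε v) → InP a b N (translate x (- ε) v) → translate x ε v ≐ x
    vertex-rigid {x} {ε} {v} (_ , extreme) P⁺ P⁻ =
      proj₁ (extreme _ _ ½ P⁺ P⁻ 0<½ ½<1 (λ k → sym (translate-midpoint x ε v k)))

    face-contains-translate : ∀ {x y p ε v} → SegIsFace a b N x y → OnSeg x y p →
      InP a b N (translate p ε v) → InP a b N (translate p (- ε) v) → OnSeg x y (translate p ε v)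
    face-contains-translate {p = p} {ε} {v} face (t , 0≤t , t≤1 , p≐) P⁺ P⁻ =
      proj₁ (face _ _ ½ P⁺ P⁻ 0<½ ½<1 (t , 0≤t , t≤1 , λ k → trans (translate-midpoint p ε v k) (p≐ k)))

    vertex-interior-unique : ∀ {x i j} → IsVertex a b N x → Interior i (x i) → Interior j (x j) → i ≡ j
    vertex-interior-unique {x} {i} {j} vx i-int j-int = decidable-stable (i ≟ᶠ j) λ i≢j →
      let (ε , 0<ε , P⁺ , P⁻) = interior-pair-line {x} {i} {j} (proj₁ vx) i≢j i-int j-int
      in  <⇒≢ 0<ε (sym (identityʳ-unique (x i) ε
            (trans (sym (translate-transfer-source {i = i} {j} x ε)) (vertex-rigid {x} {ε} {transfer i j} vx P⁺ P⁻ i))))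

    edge-midpoint-two-interior⇒agree : ∀ {x y k i} → SegIsFace a b N x y → InP a b N x → InP a b N y → k ≢ i →
      Interior k (comb ½ x y k) → Interior i (comb ½ x y i) → ∀ {j} → j ≢ k → j ≢ i → x j ≡ y j
    edge-midpoint-two-interior⇒agree {x} {y} {k} {i} face Px Py k≢i k-int i-int {j} j≢k j≢i =
      decidable-stable (x j ≟ y j) λ xj≢yj →
        let (s , _ , _ , m⁺≐) = face-contains-translate {x} {y} {m} {ε} {transfer k i} face
                                  (½ , <⇒≤ 0<½ , <⇒≤ ½<1 , λ _ → refl) P⁺ P⁻
            s≡½ = mix-injective {s} {½} xj≢yj (trans (sym (m⁺≐ j)) (translate-transfer-off {i = k} {i} m ε j≢k j≢i))
        in  <⇒≢ 0<ε (sym (identityʳ-unique (m k) ε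
              (trans (sym (translate-transfer-source {i = k} {i} m ε))
                     (trans (m⁺≐ k) (cong (λ t → mix t (x k) (y k)) s≡½)))))
      where
      m : Pt n
      m = comb ½ x y
      line = interior-pair-line {m} {k} {i} (comb-InP (<⇒≤ 0<½) (<⇒≤ ½<1) Px Py) k≢i k-int i-int
      ε = proj₁ line
      0<ε = proj₁ (proj₂ line)
      P⁺ = proj₁ (proj₂ (proj₂ line))
      P⁻ = proj₂ (proj₂ (proj₂ line))

    exchange : ∀ {x z i j} → InP a b N x → InP a b N z → i ≢ j →
      (∀ k → k ≢ i → k ≢ j → z k ≡ x k) → z i ≡ x i - (z j - x j)
    exchange {x} {z} {i} {j} (_ , Σx) (_ , Σz) i≢j agree =
      trans (sym (add-sub-cancel (x i) (z i))) (cong (x i +_) (inverseˡ-unique _ _ balance))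
      where
      open ≡-Reasoning
      balance : (z i - x i) + (z j - x j) ≡ 0ℚ
      balance = begin
        (z i - x i) + (z j - x j) ≡⟨ sumℚ-pair (λ k → z k - x k) i≢j
                                       (λ k k≢i k≢j → trans (cong (_- x k) (agree k k≢i k≢j)) (+-inverseʳ (x k))) ⟨
        sumℚ (λ k → z k - x k)    ≡⟨ sumℚ-distrib-- z x ⟩
        sumℚ z - sumℚ x           ≡⟨ cong₂ _-_ Σz Σx ⟩
        ℕ→ℚ N - ℕ→ℚ N             ≡⟨ +-inverseʳ (ℕ→ℚ N) ⟩
        0ℚ                        ∎

    exchange-≤-δ : ∀ {x z i j} → InP a b N x → InP a b N z → i ≢ j →
      (∀ k → k ≢ i → k ≢ j → z k ≡ x k) → z j - x j ≤ δ x i j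
    exchange-≤-δ {x} {z} {i} {j} Px Pz@(z-box , _) i≢j agree =
      ⊓-glb (+-monoˡ-≤ (- x j) (proj₂ (z-box j)))
            (p≤q-r⇒r≤q-p {q = x i} (subst (lo a b i ≤_) (exchange Px Pz i≢j agree) (proj₁ (z-box i))))

    edge-fixes-other-coordinates : ∀ {x y i j} → InP a b N x → InP a b N y → SegIsFace a b N x y →
      y i < x i → x j < y j → ∀ k → k ≢ i → k ≢ j → y k ≡ x k × (x k ≡ lo a b k ⊎ x k ≡ up a b k)
    edge-fixes-other-coordinates {x} {y} {i} {j} Px Py face yi<xi xj<yj k k≢i k≢j = unmoved , at-bound
      where
      i≢j : i ≢ j
      i≢j refl = <-asym yi<xi xj<yj
      moved-interior : ∀ {k} → x k ≢ y k → Interior k (comb ½ x y k)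
      moved-interior {k} = midpoint-interior (proj₁ Px k) (proj₁ Py k)
      boundary : ¬ Interior k (comb ½ x y k)
      boundary k-int = <⇒≢ xj<yj
        (edge-midpoint-two-interior⇒agree {x} {y} {k} {i} face Px Py k≢i k-int (moved-interior (<⇒≢ yi<xi ∘ sym))
          (k≢j ∘ sym) (i≢j ∘ sym))
      unmoved : y k ≡ x k
      unmoved = decidable-stable (y k ≟ x k) λ yk≢xk → boundary (moved-interior (yk≢xk ∘ sym))
      xk≡mk : x k ≡ comb ½ x y k
      xk≡mk = sym (trans (cong (mix ½ (x k)) unmoved) (mix-idem ½ (x k)))
      at-bound : x k ≡ lo a b k ⊎ x k ≡ up a b k
      at-bound = [ inj₁ , [ inj₂ , (λ k-int → contradiction (subst (Interior k) xk≡mk k-int) boundary) ]′ ]′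
                   (box-cases (proj₁ Px k))

    adjacent⇒transfer : ∀ {x y i j} → IsVertex a b N x → IsVertex a b N y → SegIsFace a b N x y →
      y i < x i → x j < y j → IsTransfer x y i j
    adjacent⇒transfer {x} {y} {i} {j} (Px , _) vy@(Py , _) face yi<xi xj<yj =
      fixed , trans (sym (add-sub-cancel (x j) (y j))) (cong (x j +_) d≡δ) , trans yi≡ (cong (λ e → x i - e) d≡δ)
      where
      i≢j : i ≢ j
      i≢j refl = <-asym yi<xi xj<yj
      fixed = edge-fixes-other-coordinates Px Py face yi<xi xj<yj
      d = y j - x j
      yi≡ : y i ≡ x i - d
      yi≡ = exchange Px Py i≢j (λ k k≢i k≢j → proj₁ (fixed k k≢i k≢j))
      y-interior-i : d < δ x i j → Interior i (y i)
      y-interior-i d<δ =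
        subst (lo a b i <_) (sym yi≡) (p<q-r⇒r<q-p {q = x i} (<-≤-trans d<δ (p⊓q≤q (up a b j - x j) (x i - lo a b i)))) ,
        <-≤-trans yi<xi (proj₂ (proj₁ Px i))
      y-interior-j : d < δ x i j → Interior j (y j)
      y-interior-j d<δ =
        ≤-<-trans (proj₁ (proj₁ Px j)) xj<yj ,
        subst (_< up a b j) (add-sub-cancel (x j) (y j))
          (r<q-p⇒p+r<q (<-≤-trans d<δ (p⊓q≤p (up a b j - x j) (x i - lo a b i))))
      d≡δ : d ≡ δ x i j
      d≡δ = ≤-antisym (exchange-≤-δ Px Py i≢j (λ k k≢i k≢j → proj₁ (fixed k k≢i k≢j))) (≮⇒≥ λ d<δ →
              i≢j (vertex-interior-unique {y} {i} {j} vy (y-interior-i d<δ) (y-interior-j d<δ)))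

    transfer-nondegenerate : ∀ {x y i j} → InP a b N x → ¬ x ≐ y → IsTransfer x y i j → 0ℚ < δ x i j × i ≢ j
    transfer-nondegenerate {x} {y} {i} {j} (x-box , _) x≢y (off , yj≡ , yi≡) = 0<δ , i≢j
      where
      0≤δ : 0ℚ ≤ δ x i j
      0≤δ = ⊓-glb (p≤q⇒0≤q-p (proj₂ (x-box j))) (p≤q⇒0≤q-p (proj₁ (x-box i)))
      unchanged : 0ℚ ≡ δ x i j → x ≐ y
      unchanged 0≡δ = pair-cases i j
        (sym (trans yi≡ (trans (cong (λ e → x i - e) (sym 0≡δ)) (+-identityʳ (x i)))))
        (sym (trans yj≡ (trans (cong (x j +_) (sym 0≡δ)) (+-identityʳ (x j)))))
        (λ k k≢i k≢j → sym (proj₁ (off k k≢i k≢j)))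
      0<δ : 0ℚ < δ x i j
      0<δ = [ (λ 0<δ → 0<δ) , (λ 0≡δ → contradiction (unchanged 0≡δ) x≢y) ]′ (≤⇒<⊎≡ 0≤δ)
      i≢j : i ≢ j
      i≢j refl = <⇒≢ (p-r<p+r (x i) 0<δ) (trans (sym yi≡) yj≡)

    vertex-tight : ∀ {x i j} → IsVertex a b N x → i ≢ j → 0ℚ < δ x i j → x i ≡ up a b i ⊎ x j ≡ lo a b j
    vertex-tight {x} {i} {j} vx@(Px , _) i≢j 0<δ = tight-i (box-cases (proj₁ Px i))
      where
      tight-j : Interior i (x i) → x j ≡ lo a b j ⊎ x j ≡ up a b j ⊎ Interior j (x j) →
                x i ≡ up a b i ⊎ x j ≡ lo a b j
      tight-j _     (inj₁ xj≡l)         = inj₂ xj≡l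
      tight-j _     (inj₂ (inj₁ xj≡u))  =
        contradiction xj≡u (<⇒≢ (0<q-p⇒p<q (<-≤-trans 0<δ (p⊓q≤p (up a b j - x j) (x i - lo a b i)))))
      tight-j i-int (inj₂ (inj₂ j-int)) = contradiction (vertex-interior-unique {x} {i} {j} vx i-int j-int) i≢j
      tight-i : x i ≡ lo a b i ⊎ x i ≡ up a b i ⊎ Interior i (x i) → x i ≡ up a b i ⊎ x j ≡ lo a b j
      tight-i (inj₁ xi≡l)         =
        contradiction (sym xi≡l) (<⇒≢ (0<q-p⇒p<q (<-≤-trans 0<δ (p⊓q≤q (up a b j - x j) (x i - lo a b i)))))
      tight-i (inj₂ (inj₁ xi≡u))  = inj₁ xi≡u
      tight-i (inj₂ (inj₂ i-int)) = tight-j i-int (box-cases (proj₁ Px j))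

    transfer-onSeg : ∀ {x y z i j} → InP a b N x → IsTransfer x y i j → i ≢ j → 0ℚ < δ x i j →
      x i ≡ up a b i ⊎ x j ≡ lo a b j → InP a b N z → (∀ k → k ≢ i → k ≢ j → z k ≡ x k) → OnSeg x y z
    transfer-onSeg {x} {y} {z} {i} {j} Px (off , yj≡ , yi≡) i≢j 0<δ tight Pz@(z-box , _) agree =
      r , 0≤r , r≤1 , pair-cases i j at-i at-j at-off
      where
      d = z j - x j
      zi≡ : z i ≡ x i - d
      zi≡ = exchange Px Pz i≢j agree
      0≤d : 0ℚ ≤ d
      0≤d = [ (λ xi≡u → subst (0ℚ ≤_) (trans (cong (λ e → x i - e) zi≡) (sub-sub-cancel (x i) d))
                            (p≤q⇒0≤q-p (subst (z i ≤_) (sym xi≡u) (proj₂ (z-box i)))))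
            , (λ xj≡l → p≤q⇒0≤q-p (subst (_≤ z j) (sym xj≡l) (proj₁ (z-box j)))) ]′ tight
      parameter = segment-parameter 0<δ 0≤d (exchange-≤-δ Px Pz i≢j agree)
      r = proj₁ parameter
      0≤r = proj₁ (proj₂ parameter)
      r≤1 = proj₁ (proj₂ (proj₂ parameter))
      [1-r]δ≡d = proj₂ (proj₂ (proj₂ parameter))
      open ≡-Reasoning
      at-i : z i ≡ comb r x y i
      at-i = begin
        z i                         ≡⟨ zi≡ ⟩
        x i - d                     ≡⟨ cong (λ e → x i - e) [1-r]δ≡d ⟨
        x i - (1ℚ - r) * δ x i j    ≡⟨ mix-shift-- r (x i) (δ x i j) ⟨
        mix r (x i) (x i - δ x i j) ≡⟨ cong (mix r (x i)) yi≡ ⟨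
        comb r x y i                ∎
      at-j : z j ≡ comb r x y j
      at-j = begin
        z j                         ≡⟨ add-sub-cancel (x j) (z j) ⟨
        x j + d                     ≡⟨ cong (x j +_) [1-r]δ≡d ⟨
        x j + (1ℚ - r) * δ x i j    ≡⟨ mix-shift-+ r (x j) (δ x i j) ⟨
        mix r (x j) (x j + δ x i j) ≡⟨ cong (mix r (x j)) yj≡ ⟨
        comb r x y j                ∎
      at-off : ∀ k → k ≢ i → k ≢ j → z k ≡ comb r x y k
      at-off k k≢i k≢j = begin
        z k               ≡⟨ agree k k≢i k≢j ⟩
        x k               ≡⟨ mix-idem r (x k) ⟨
        mix r (x k) (x k) ≡⟨ cong (mix r (x k)) (proj₁ (off k k≢i k≢j)) ⟨
        comb r x y k      ∎

    transfer⇒face : ∀ {x y i j} → IsVertex a b N x → ¬ x ≐ y → IsTransfer x y i j → SegIsFace a b N x y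
    transfer⇒face {x} {y} {i} {j} vx@(Px , _) x≢y tr@(off , _) z w t Pz@(z-box , _) Pw@(w-box , _) 0<t t<1
                  (s , _ , _ , zw≐) =
      on-segment Pz (λ k k≢i k≢j → proj₁ (pinned k k≢i k≢j)) ,
      on-segment Pw (λ k k≢i k≢j → proj₂ (pinned k k≢i k≢j))
      where
      nondegenerate = transfer-nondegenerate Px x≢y tr
      0<δ = proj₁ nondegenerate
      i≢j = proj₂ nondegenerate
      on-segment : ∀ {p} → InP a b N p → (∀ k → k ≢ i → k ≢ j → p k ≡ x k) → OnSeg x y p
      on-segment = transfer-onSeg Px tr i≢j 0<δ (vertex-tight {x} {i} {j} vx i≢j 0<δ)
      pinned : ∀ k → k ≢ i → k ≢ j → z k ≡ x k × w k ≡ x k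
      pinned k k≢i k≢j =
        mix-at-bound 0<t t<1 (z-box k) (w-box k) (proj₂ (off k k≢i k≢j))
          (trans (zw≐ k) (trans (cong (mix s (x k)) (proj₁ (off k k≢i k≢j))) (mix-idem s (x k))))

-- The hypotheses Σ a = Σ b = N only make P nonempty; the characterisation does not use them.
lemma2 : ∀ (n : ℕ) (a b : Fin n → ℕ) (N : ℕ) →
    sumℕ a ≡ N → sumℕ b ≡ N →
    (x y : Pt n) → IsVertex a b N x → IsVertex a b N y → ¬ (x ≐ y) →
    Adjacent a b N x y ⇔
      ∃₂ λ (i j : Fin n) →
        (∀ k → k ≢ i → k ≢ j →
           y k ≡ x k × (x k ≡ lo a b k ⊎ x k ≡ up a b k)) ×
        y j ≡ x j + ((up a b j - x j) ⊓ (x i - lo a b i)) ×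
        y i ≡ x i - ((up a b j - x j) ⊓ (x i - lo a b i))
lemma2 n a b N _ _ x y vx@((_ , Σx) , _) vy@((_ , Σy) , _) x≢y = mk⇔ forward backward
  where
  forward : Adjacent a b N x y → ∃₂ (IsTransfer a b x y)
  forward (_ , _ , _ , face) =
    let (i , j , yi<xi , xj<yj) = sumℚ-≡⇒decrease×increase (trans Σx (sym Σy)) x≢y
    in  i , j , adjacent⇒transfer a b N vx vy face yi<xi xj<yj
  backward : ∃₂ (IsTransfer a b x y) → Adjacent a b N x y
  backward (i , j , transfer) = vx , vy , x≢y , transfer⇒face a b N vx x≢y transfer
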